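{- The functor $\mathcal{P}^{\infty}_b:\mathbf{Sets}\to\mathbf{Sets}$ preserves pullbacks along injective morphisms: if $A$ with projections $\pi_B:A\to B$, $\pi_C:A\to C$ is a pullback in $\mathbf{Sets}$ of $f_1:B\to D$ and $g_1:C\to D$ with $g_1$ injective, then $\mathcal{P}^{\infty}_b(A)$ with $\widehat{\pi_B},\widehat{\pi_C}$ is a pullback of $\widehat{f_1}$ and $\widehat{g_1}$.
   Context: For a set $M$ whose elements are regarded as atoms (urelements, not sets), put $T_0=\mathcal{P}(M)$, $T_{k+1}=T_k\cup\mathcal{P}(T_k)$ and $\mathcal{P}^{\infty}_b(M)=\bigcup_{k\ge0}T_k$. For a function $f:M\to N$, $\widehat f=\mathcal{P}^{\infty}_b(f):\mathcal{P}^{\infty}_b(M)\to\mathcal{P}^{\infty}_b(N)$ is defined recursively by $\widehat f(X)=\{\widehat f(y)\mid y\in X\}$, where $\widehat f(y):=f(y)$ for $y\in M$. -}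

module Defs where

open import Level using (Level; _⊔_; Setω) renaming (suc to lsuc; zero to lzero)
open import Data.Nat using (ℕ; zero; suc)
open import Data.Empty using (⊥)
open import Data.Unit using (⊤)
open import Data.Sum using (_⊎_)
open import Data.Product using (Σ; ∃; _×_)
open import Relation.Binary.PropositionalEquality using (_≡_)
open import Relation.Binary.Bundles using (Setoid)
open import Function.Definitions using (Injective)

-- Sets with atoms (urelements) from M, in the style of Aczel:
-- a set is given by an index type I and a family I → V M of its elements.
data V (M : Set) : Set₁ where
  atom : M → V M
  sup  : (I : Set) → (I → V M) → V M

_≐_ : {M : Set} → V M → V M → Set
atom a ≐ atom b = a ≡ b
atom _ ≐ sup _ _ = ⊥
sup _ _ ≐ atom _ = ⊥
sup I f ≐ sup J g =
  ((i : I) → Σ J (λ j → f i ≐ g j)) × ((j : J) → Σ I (λ i → f i ≐ g j))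

infix 4 _≐_

IsAtom : {M : Set} → V M → Set
IsAtom (atom _) = ⊤
IsAtom (sup _ _) = ⊥

-- InT k x : x ∈ T_k, where T_0 = P(M), T_{k+1} = T_k ∪ P(T_k)
InT : {M : Set} → ℕ → V M → Set
InT _ (atom _) = ⊥
InT zero (sup I f) = (i : I) → IsAtom (f i)
InT (suc k) (sup I f) = InT k (sup I f) ⊎ ((i : I) → InT k (f i))

-- x ∈ P^∞_b(M) = ⋃_k T_k
InPb : {M : Set} → V M → Set
InPb x = Σ ℕ (λ k → InT k x)

hat : {M N : Set} → (M → N) → V M → V N
hat f (atom a) = atom (f a)
hat f (sup I h) = sup I (λ i → hat f (h i))

IsPullback : {A B C D : Set} → (A → B) → (A → C) → (B → D) → (C → D) → Set₁
IsPullback {A} {B} {C} πB πC f1 g1 =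
  ((a : A) → f1 (πB a) ≡ g1 (πC a)) ×
  ((X : Set) (u : X → B) (v : X → C) → ((x : X) → f1 (u x) ≡ g1 (v x)) →
    Σ (X → A) (λ h →
      ((x : X) → πB (h x) ≡ u x) × ((x : X) → πC (h x) ≡ v x) ×
      ((h' : X → A) → ((x : X) → πB (h' x) ≡ u x) → ((x : X) → πC (h' x) ≡ v x) →
        (x : X) → h' x ≡ h x)))

-- Elements of P^∞_b are elements of V satisfying InPb, identified up to ≐;
-- test objects X range over arbitrary setoids (sets), maps must respect equality.
record IsPullbackPb {A B C D : Set} (πB : A → B) (πC : A → C) (f1 : B → D) (g1 : C → D) : Setω where
  field
    commutes : (a : V A) → InPb a → hat f1 (hat πB a) ≐ hat g1 (hat πC a)
    universal : {c ℓ : Level} (X : Setoid c ℓ) → let open Setoid X using (Carrier; _≈_) in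
      (u : Carrier → V B) (v : Carrier → V C) →
      ((x : Carrier) → InPb (u x)) → ((x : Carrier) → InPb (v x)) →
      ({x y : Carrier} → x ≈ y → u x ≐ u y) → ({x y : Carrier} → x ≈ y → v x ≐ v y) →
      ((x : Carrier) → hat f1 (u x) ≐ hat g1 (v x)) →
      Σ (Carrier → V A) (λ h →
        ((x : Carrier) → InPb (h x)) × ({x y : Carrier} → x ≈ y → h x ≐ h y) ×
        ((x : Carrier) → hat πB (h x) ≐ u x) × ((x : Carrier) → hat πC (h x) ≐ v x) ×
        ((h' : Carrier → V A) → ((x : Carrier) → InPb (h' x)) →
          ({x y : Carrier} → x ≈ y → h' x ≐ h' y) →
          ((x : Carrier) → hat πB (h' x) ≐ u x) → ((x : Carrier) → hat πC (h' x) ≐ v x) →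
          (x : Carrier) → h' x ≐ h x))

module Submission where

-- Elements of P^∞_b are well-founded trees taken up to
-- extensional equality ≐, and hat f relabels the atoms of a tree by f.
-- (1) General facts about ≐ and hat: ≐ is an equivalence, hat f preserves ≐,
--     hat g reflects ≐ when g is injective, and hat turns a commuting square
--     of maps into a square commuting up to ≐.  Membership in T_k respects ≐
--     and is reflected by hat.
-- (2) General facts about a pullback A of f1, g1 in Sets: the projections are
--     jointly monic, every compatible pair (b , c) has a mediating point, and
--     πB is injective as soon as g1 is (pullbacks preserve monos).
-- (3) Given trees s, t with hat f1 s ≐ hat g1 t we build a tree lift s t of
--     the same shape as s by replacing each atom b by the point of A over b
--     and the matching atom c of t; then hat πB (lift s t) ≐ s.  The equation
--     hat πC (lift s t) ≐ t follows by cancelling the injective g1, and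
--     uniqueness of mediating maps from injectivity of πB.

open import Defs
open import Relation.Binary.PropositionalEquality using (_≡_; refl; sym; trans; cong)
open import Function.Definitions using (Injective)
open import Data.Nat using (ℕ; zero; suc)
open import Data.Unit using (⊤; tt)
open import Data.Sum using (inj₁; inj₂)
open import Data.Product using (Σ; _×_; _,_; proj₁; proj₂)
open import Relation.Binary.Bundles using (Setoid)
open import Level using (0ℓ) renaming (suc to lsuc)
import Relation.Binary.Reasoning.Setoid as SetoidReasoning

≐-refl : {M : Set} {s : V M} → s ≐ s
≐-refl {s = atom a} = refl
≐-refl {s = sup I f} = (λ i → i , ≐-refl) , (λ i → i , ≐-refl)

≐-sym : {M : Set} {s t : V M} → s ≐ t → t ≐ s
≐-sym {s = atom a} {atom b} p = sym p
≐-sym {s = sup I f} {sup J g} (p , q) =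
  (λ j → proj₁ (q j) , ≐-sym (proj₂ (q j))) ,
  (λ i → proj₁ (p i) , ≐-sym (proj₂ (p i)))

≐-trans : {M : Set} {s t r : V M} → s ≐ t → t ≐ r → s ≐ r
≐-trans {s = atom a} {atom b} {atom c} p q = trans p q
≐-trans {s = sup I f} {sup J g} {sup K h} (p , p') (q , q') =
  (λ i → proj₁ (q (proj₁ (p i))) , ≐-trans (proj₂ (p i)) (proj₂ (q (proj₁ (p i))))) ,
  (λ k → proj₁ (p' (proj₁ (q' k))) , ≐-trans (proj₂ (p' (proj₁ (q' k)))) (proj₂ (q' k)))

≐-setoid : Set → Setoid (lsuc 0ℓ) 0ℓ
≐-setoid M = record
  { Carrier = V M
  ; _≈_ = _≐_
  ; isEquivalence = record { refl = ≐-refl ; sym = ≐-sym ; trans = ≐-trans }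
  }

hat-resp-≐ : {M N : Set} (f : M → N) {s t : V M} → s ≐ t → hat f s ≐ hat f t
hat-resp-≐ f {atom a} {atom b} p = cong f p
hat-resp-≐ f {sup I g} {sup J h} (p , q) =
  (λ i → proj₁ (p i) , hat-resp-≐ f (proj₂ (p i))) ,
  (λ j → proj₁ (q j) , hat-resp-≐ f (proj₂ (q j)))

hat-reflects-≐ : {M N : Set} (g : M → N) → Injective _≡_ _≡_ g →
  {s t : V M} → hat g s ≐ hat g t → s ≐ t
hat-reflects-≐ g inj {atom a} {atom b} p = inj p
hat-reflects-≐ g inj {sup I f} {sup J h} (p , q) =
  (λ i → proj₁ (p i) , hat-reflects-≐ g inj (proj₂ (p i))) ,
  (λ j → proj₁ (q j) , hat-reflects-≐ g inj (proj₂ (q j)))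

hat-square : {M P Q N : Set} (g : M → P) (g' : M → Q) (f : P → N) (f' : Q → N) →
  ((a : M) → f (g a) ≡ f' (g' a)) → (s : V M) → hat f (hat g s) ≐ hat f' (hat g' s)
hat-square g g' f f' sq (atom a) = sq a
hat-square g g' f f' sq (sup I h) =
  (λ i → i , hat-square g g' f f' sq (h i)) , (λ i → i , hat-square g g' f f' sq (h i))

IsAtom-resp-≐ : {M : Set} {s t : V M} → s ≐ t → IsAtom s → IsAtom t
IsAtom-resp-≐ {s = atom a} {atom b} _ _ = tt

InT-resp-≐ : {M : Set} (k : ℕ) {s t : V M} → s ≐ t → InT k s → InT k t
InT-resp-≐ zero {sup I f} {sup J g} (_ , q) atoms j =
  IsAtom-resp-≐ (proj₂ (q j)) (atoms (proj₁ (q j)))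
InT-resp-≐ (suc k) {sup I f} {sup J g} e (inj₁ inT) = inj₁ (InT-resp-≐ k e inT)
InT-resp-≐ (suc k) {sup I f} {sup J g} (_ , q) (inj₂ elems) =
  inj₂ (λ j → InT-resp-≐ k (proj₂ (q j)) (elems (proj₁ (q j))))

-- hat only relabels atoms, so it reflects membership in T_k.

hat-reflects-IsAtom : {M N : Set} (f : M → N) (s : V M) → IsAtom (hat f s) → IsAtom s
hat-reflects-IsAtom f (atom a) _ = tt

hat-reflects-InT : {M N : Set} (f : M → N) (k : ℕ) (s : V M) → InT k (hat f s) → InT k s
hat-reflects-InT f zero (sup I g) atoms i = hat-reflects-IsAtom f (g i) (atoms i)
hat-reflects-InT f (suc k) (sup I g) (inj₁ inT) = inj₁ (hat-reflects-InT f k (sup I g) inT)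
hat-reflects-InT f (suc k) (sup I g) (inj₂ elems) =
  inj₂ (λ i → hat-reflects-InT f k (g i) (elems i))

-- Elementary consequences of the universal property of a pullback in Sets,
-- obtained by testing it against the one-point set.
module PullbackOfSets {A B C D : Set} (πB : A → B) (πC : A → C) (f1 : B → D) (g1 : C → D)
                      (pb : IsPullback πB πC f1 g1) where

  commutes : (a : A) → f1 (πB a) ≡ g1 (πC a)
  commutes = proj₁ pb

  private
    mediate : (b : B) (c : C) (p : f1 b ≡ g1 c) →
      Σ (⊤ → A) (λ h → ((x : ⊤) → πB (h x) ≡ b) × ((x : ⊤) → πC (h x) ≡ c) ×
        ((h' : ⊤ → A) → ((x : ⊤) → πB (h' x) ≡ b) → ((x : ⊤) → πC (h' x) ≡ c) →
          (x : ⊤) → h' x ≡ h x))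
    mediate b c p = proj₂ pb ⊤ (λ _ → b) (λ _ → c) (λ _ → p)

  pair : (b : B) (c : C) → f1 b ≡ g1 c → A
  pair b c p = proj₁ (mediate b c p) tt

  pair-πB : (b : B) (c : C) (p : f1 b ≡ g1 c) → πB (pair b c p) ≡ b
  pair-πB b c p = proj₁ (proj₂ (mediate b c p)) tt

  jointly-monic : {a a' : A} → πB a ≡ πB a' → πC a ≡ πC a' → a ≡ a'
  jointly-monic {a} {a'} eB eC = trans (to-pair a refl refl) (sym (to-pair a' (sym eB) (sym eC)))
    where
      to-pair : (z : A) → πB z ≡ πB a → πC z ≡ πC a → z ≡ pair (πB a) (πC a) (commutes a)
      to-pair z e e' =
        proj₂ (proj₂ (proj₂ (mediate (πB a) (πC a) (commutes a)))) (λ _ → z) (λ _ → e) (λ _ → e') tt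

  πB-injective : Injective _≡_ _≡_ g1 → Injective _≡_ _≡_ πB
  πB-injective g1-inj {a} {a'} e =
    jointly-monic e (g1-inj (trans (sym (commutes a)) (trans (cong f1 e) (commutes a'))))

module Lift {A B C D : Set} (πB : A → B) (πC : A → C) (f1 : B → D) (g1 : C → D)
            (g1-inj : Injective _≡_ _≡_ g1) (pb : IsPullback πB πC f1 g1) where

  open PullbackOfSets πB πC f1 g1 pb

  -- A tree of the same shape as s whose atoms are the points over the
  -- corresponding atoms of s and their partners in t.
  lift : (s : V B) (t : V C) → hat f1 s ≐ hat g1 t → V A
  lift (atom b) (atom c) p = atom (pair b c p)
  lift (sup I f) (sup J g) (p , _) = sup I (λ i → lift (f i) (g (proj₁ (p i))) (proj₂ (p i)))

  lift-πB : (s : V B) (t : V C) (p : hat f1 s ≐ hat g1 t) → hat πB (lift s t p) ≐ s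
  lift-πB (atom b) (atom c) p = pair-πB b c p
  lift-πB (sup I f) (sup J g) (p , _) =
    (λ i → i , lift-πB (f i) (g (proj₁ (p i))) (proj₂ (p i))) ,
    (λ i → i , lift-πB (f i) (g (proj₁ (p i))) (proj₂ (p i)))

  -- Since g1 is injective, the C-projection is forced by the B-projection.
  lift-πC : (s : V B) (t : V C) (p : hat f1 s ≐ hat g1 t) → hat πC (lift s t p) ≐ t
  lift-πC s t p = hat-reflects-≐ g1 g1-inj (begin
      hat g1 (hat πC (lift s t p)) ≈⟨ ≐-sym (hat-square πB πC f1 g1 commutes (lift s t p)) ⟩
      hat f1 (hat πB (lift s t p)) ≈⟨ hat-resp-≐ f1 (lift-πB s t p) ⟩
      hat f1 s                     ≈⟨ p ⟩
      hat g1 t                     ∎)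
    where open SetoidReasoning (≐-setoid D)

  lift-InPb : (s : V B) (t : V C) (p : hat f1 s ≐ hat g1 t) → InPb s → InPb (lift s t p)
  lift-InPb s t p (k , inT) =
    k , hat-reflects-InT πB k (lift s t p) (InT-resp-≐ k (≐-sym (lift-πB s t p)) inT)

  determined-by-πB : {z z' : V A} → hat πB z ≐ hat πB z' → z ≐ z'
  determined-by-πB = hat-reflects-≐ πB (πB-injective g1-inj)

  same-πB : {z z' : V A} {s s' : V B} → hat πB z ≐ s → s ≐ s' → hat πB z' ≐ s' → z ≐ z'
  same-πB e e' e'' = determined-by-πB (≐-trans e (≐-trans e' (≐-sym e'')))

lemma6 : {A B C D : Set} (πB : A → B) (πC : A → C) (f1 : B → D) (g1 : C → D) →
    Injective _≡_ _≡_ g1 → IsPullback πB πC f1 g1 → IsPullbackPb πB πC f1 g1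
lemma6 πB πC f1 g1 g1-inj pb = record
  { commutes = λ a _ → hat-square πB πC f1 g1 commutes a
  ; universal = λ X u v u-Pb _ u-resp _ compat →
      let h = λ x → lift (u x) (v x) (compat x)
          h-πB = λ x → lift-πB (u x) (v x) (compat x)
      in h
       , (λ x → lift-InPb (u x) (v x) (compat x) (u-Pb x))
       , (λ {x} {y} x≈y → same-πB (h-πB x) (u-resp x≈y) (h-πB y))
       , h-πB
       , (λ x → lift-πC (u x) (v x) (compat x))
       , (λ h' _ _ h'-πB _ x → same-πB (h'-πB x) ≐-refl (h-πB x))
  }
  where
    open PullbackOfSets πB πC f1 g1 pb using (commutes)
    open Lift πB πC f1 g1 g1-inj pb
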